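{- Let $p, q$ be distinct primes and $n = pq$. Then the zero-divisor graph $\Gamma(\mathbb{Z}_n)$ is a very cost effective graph.
   Context: $\mathbb{Z}_n$ is the ring of residue classes modulo $n$. The zero-divisor graph $\Gamma(\mathbb{Z}_n)$ has as vertices the nonzero zero-divisors of $\mathbb{Z}_n$, two distinct vertices $x,y$ being adjacent iff $xy = 0$. For a graph $G=(V,E)$, $N(v)$ denotes the open neighborhood of $v$. Given $S \subseteq V$, a vertex $v \in S$ is very cost effective if $|N(v)\cap S| < |N(v) \cap (V\setminus S)|$; a set $S$ is very cost effective if every vertex of $S$ is very cost effective. A bipartition $\{S, V\setminus S\}$ of $V$ is very cost effective if both parts are very cost effective sets, and $G$ is a very cost effective graph if it has a very cost effective bipartition. -}

module Defs where

open import Data.Nat using (ℕ; zero; suc; _+_; _*_; _<_; NonZero)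
open import Data.Nat.Divisibility using (_∣?_)
open import Data.Nat.Properties using (_≟_)
open import Data.Bool using (Bool; true; false; not; _∧_)
open import Data.List using (List; filter; length; upTo)
open import Data.Bool.ListAction using (any)
open import Data.List.Relation.Unary.All using (All)
open import Data.Product using (Σ; ∃; _×_)
open import Relation.Binary.PropositionalEquality using (_≡_)
open import Relation.Nullary using (¬_; Dec; yes; no)
open import Relation.Nullary.Decidable using (⌊_⌋; ¬?)

-- A finite simple graph presented by a duplicate-free list of vertices
-- (natural numbers) and a symmetric, irreflexive Boolean adjacency relation.
record Graph : Set where
  field
    V   : List ℕ
    adj : ℕ → ℕ → Bool

open Graph public

nbrCount : Graph → (ℕ → Bool) → ℕ → ℕ
nbrCount G T v =
  length (filter (λ u → (adj G v u ∧ not ⌊ u ≟ v ⌋) ∧ T u Data.Bool.≟ true) (V G))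

VeryCostEffectiveVertex : Graph → (ℕ → Bool) → ℕ → Set
VeryCostEffectiveVertex G S v = nbrCount G S v < nbrCount G (λ u → not (S u)) v

VeryCostEffectiveSet : Graph → (ℕ → Bool) → Set
VeryCostEffectiveSet G S = All (λ v → S v ≡ true → VeryCostEffectiveVertex G S v) (V G)

VeryCostEffectiveGraph : Graph → Set
VeryCostEffectiveGraph G =
  Σ (ℕ → Bool) λ S → VeryCostEffectiveSet G S × VeryCostEffectiveSet G (λ u → not (S u))

module _ (n : ℕ) where
  mulZero : ℕ → ℕ → Bool
  mulZero x y = ⌊ n ∣? (x * y) ⌋

  nonzeroResidues : List ℕ
  nonzeroResidues = filter (λ x → ¬? (x ≟ 0)) (upTo n)

  isZeroDivisor : ℕ → Bool
  isZeroDivisor x = any (mulZero x) nonzeroResidues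

  zdVertices : List ℕ
  zdVertices = filter (λ x → isZeroDivisor x Data.Bool.≟ true) nonzeroResidues

  ZDGraph : Graph
  ZDGraph = record { V = zdVertices ; adj = λ x y → mulZero x y ∧ not ⌊ x ≟ y ⌋ }

module Submission where

-- Colour each nonzero zero-divisor u of ℤ_pq by S u = "p ∣ u".
-- A nonzero residue below pq is never divisible by both p and q, so pq ∣ v·u
-- forces exactly one of u, v to be a multiple of p: every edge of Γ(ℤ_pq)
-- joins the two colour classes.  Moreover every vertex v has an annihilator
-- u, which then has the other colour, so it is a genuine neighbour (u ≠ v).

open import Defs
open import Data.Nat using (ℕ; zero; suc; _*_; _<_; _≤_; z≤n; s≤s)
open import Data.Nat.Properties using (_≟_; *-comm; *-monoˡ-≤; <⇒≱)
open import Data.Nat.Divisibility using (_∣_; _∣?_; divides; ∣-trans; m∣m*n; n∣m*n; ∣⇒≤)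
open import Data.Nat.Primality using (Prime; euclidsLemma; prime⇒irreducible; ¬prime[1])
open import Data.Bool using (Bool; true; false; not; _∧_)
import Data.Bool as Bool
open import Data.Bool.Properties using (∧-conicalˡ; ∧-conicalʳ; not-¬; T-≡)
open import Data.List using (List; length)
open import Data.List.Properties using (filter-none)
open import Data.List.Membership.Propositional using (_∈_; find; lose)
open import Data.List.Membership.Propositional.Properties using (∈-filter⁺; ∈-filter⁻; ∈-upTo⁻)
open import Data.List.Relation.Unary.Any using (here; there)
open import Data.List.Relation.Unary.Any.Properties using (any⁺; any⁻)
open import Data.List.Relation.Unary.All using (tabulate)
open import Data.Product using (∃; _×_; _,_)
open import Data.Sum using (_⊎_; inj₁; inj₂; [_,_])
open import Data.Empty using (⊥-elim)
open import Function using (Equivalence)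
open import Relation.Nullary using (¬_; yes; no; contradiction)
open import Relation.Nullary.Decidable using (⌊_⌋; ¬?; toWitness; fromWitness)
open import Relation.Binary.PropositionalEquality using (_≡_; _≢_; refl; sym; trans; cong; cong₂; subst)

distinct⇒unequal : ∀ {x y} → x ≢ y → not ⌊ x ≟ y ⌋ ≡ true
distinct⇒unequal {x} {y} x≢y with x ≟ y
... | yes x≡y = contradiction x≡y x≢y
... | no _    = refl

nbrCount-zero : ∀ G T v → (∀ {u} → u ∈ V G → adj G v u ≡ true → T u ≡ false) →
                nbrCount G T v ≡ 0
nbrCount-zero G T v outside = cong length (filter-none _ (tabulate notCounted))
  where
  notCounted : ∀ {u} → u ∈ V G → ¬ (((adj G v u ∧ not ⌊ u ≟ v ⌋) ∧ T u) ≡ true)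
  notCounted {u} u∈V counted
    with adjacent ← ∧-conicalˡ _ _ (∧-conicalˡ _ _ counted)
    with inT ← ∧-conicalʳ _ _ counted
    = contradiction (trans (sym (outside u∈V adjacent)) inT) λ ()

nbrCount-pos : ∀ G T {v u} → u ∈ V G → adj G v u ≡ true → u ≢ v → T u ≡ true →
               0 < nbrCount G T v
nbrCount-pos G T {v} {u} u∈V adjacent u≢v inT =
  nonempty (∈-filter⁺ (λ w → ((adj G v w ∧ not ⌊ w ≟ v ⌋) ∧ T w) Bool.≟ true) u∈V counted)
  where
  counted : ((adj G v u ∧ not ⌊ u ≟ v ⌋) ∧ T u) ≡ true
  counted = cong₂ _∧_ (cong₂ _∧_ adjacent (distinct⇒unequal u≢v)) inT

  nonempty : ∀ {xs : List ℕ} → u ∈ xs → 0 < length xs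
  nonempty (here _)  = s≤s z≤n
  nonempty (there _) = s≤s z≤n

EdgesCross : Graph → (ℕ → Bool) → Set
EdgesCross G T = ∀ {v u} → v ∈ V G → u ∈ V G → adj G v u ≡ true → T u ≡ not (T v)

NoIsolatedVertex : Graph → Set
NoIsolatedVertex G = ∀ {v} → v ∈ V G → ∃ λ u → u ∈ V G × adj G v u ≡ true × u ≢ v

-- If all edges cross T and no vertex is isolated, each vertex of T has no
-- neighbour in T and at least one outside it, so T is very cost effective.
crossing⇒veryCostEffectiveSet : ∀ G T → EdgesCross G T → NoIsolatedVertex G →
                                VeryCostEffectiveSet G T
crossing⇒veryCostEffectiveSet G T cross hasNbr = tabulate vertexVCE
  where
  vertexVCE : ∀ {v} → v ∈ V G → T v ≡ true → VeryCostEffectiveVertex G T v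
  vertexVCE {v} v∈V inT with hasNbr v∈V
  ... | u , u∈V , adjacent , u≢v =
    subst (_< nbrCount G (λ w → not (T w)) v) (sym noneInside)
      (nbrCount-pos G (λ w → not (T w)) u∈V adjacent u≢v (cong not uOutside))
    where
    otherSide : ∀ {w} → w ∈ V G → adj G v w ≡ true → T w ≡ false
    otherSide w∈V vw = trans (cross v∈V w∈V vw) (cong not inT)

    uOutside : T u ≡ false
    uOutside = otherSide u∈V adjacent

    noneInside : nbrCount G T v ≡ 0
    noneInside = nbrCount-zero G T v otherSide

bipartite⇒veryCostEffective : ∀ G S → EdgesCross G S → NoIsolatedVertex G →
                              VeryCostEffectiveGraph G
bipartite⇒veryCostEffective G S cross hasNbr =
  S , crossing⇒veryCostEffectiveSet G S cross hasNbr
    , crossing⇒veryCostEffectiveSet G (λ u → not (S u))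
        (λ v∈V u∈V vu → cong not (cross v∈V u∈V vu)) hasNbr

module ZeroDivisorGraph (n : ℕ) where

  vertex-range : ∀ {v} → v ∈ zdVertices n → 0 < v × v < n
  vertex-range {v} v∈V
    with v∈R , _ ← ∈-filter⁻ (λ x → isZeroDivisor n x Bool.≟ true) {xs = nonzeroResidues n} v∈V
    with v<n , v≢0 ← ∈-filter⁻ (λ x → ¬? (x ≟ 0)) v∈R
    = positive v v≢0 , ∈-upTo⁻ v<n
    where
    positive : ∀ x → x ≢ 0 → 0 < x
    positive zero    x≢0 = contradiction refl x≢0
    positive (suc x) _   = s≤s z≤n

  mulZero⇒∣ : ∀ x y → mulZero n x y ≡ true → n ∣ x * y
  mulZero⇒∣ x y test = toWitness {a? = n ∣? x * y} (Equivalence.from T-≡ test)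

  ∣⇒mulZero : ∀ x y → n ∣ x * y → mulZero n x y ≡ true
  ∣⇒mulZero x y n∣xy = Equivalence.to T-≡ (fromWitness {a? = n ∣? x * y} n∣xy)

  -- Every vertex v is annihilated by some vertex u (possibly u = v).
  vertex-annihilator : ∀ {v} → v ∈ zdVertices n → ∃ λ u → u ∈ zdVertices n × n ∣ v * u
  vertex-annihilator {v} v∈V
    with v∈R , isZD ← ∈-filter⁻ (λ x → isZeroDivisor n x Bool.≟ true) {xs = nonzeroResidues n} v∈V
    with u , u∈R , vu≡0 ← find (any⁻ (mulZero n v) (nonzeroResidues n) (Equivalence.from T-≡ isZD))
    = u , u∈V , n∣vu
    where
    n∣vu : n ∣ v * u
    n∣vu = mulZero⇒∣ v u (Equivalence.to T-≡ vu≡0)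

    uv≡0 : mulZero n u v ≡ true
    uv≡0 = ∣⇒mulZero u v (subst (n ∣_) (*-comm v u) n∣vu)

    u∈V : u ∈ zdVertices n
    u∈V = ∈-filter⁺ (λ x → isZeroDivisor n x Bool.≟ true) u∈R
            (Equivalence.to T-≡ (any⁺ (mulZero n u) (lose v∈R (Equivalence.from T-≡ uv≡0))))

prime-divides-factor : ∀ {r n} v u → Prime r → r ∣ n → n ∣ v * u → r ∣ v ⊎ r ∣ u
prime-divides-factor v u r-prime r∣n n∣vu = euclidsLemma v u r-prime (∣-trans r∣n n∣vu)

module DistinctPrimes (p q : ℕ) (p-prime : Prime p) (q-prime : Prime q) (p≢q : p ≢ q) where

  open ZeroDivisorGraph (p * q)

  -- No residue strictly between 0 and pq is a multiple of both p and q: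
  -- writing v = b·p, q ∤ p forces q ∣ b, hence b ≥ q and v ≥ pq.
  notBothMultiples : ∀ {v} → 0 < v → v < p * q → p ∣ v → ¬ q ∣ v
  notBothMultiples 0<v v<pq (divides b refl) q∣bp with euclidsLemma b p q-prime q∣bp
  ... | inj₂ q∣p with prime⇒irreducible p-prime q∣p
  ...   | inj₁ q≡1 = ¬prime[1] (subst Prime q≡1 q-prime)
  ...   | inj₂ q≡p = p≢q (sym q≡p)
  notBothMultiples 0<v v<pq (divides zero refl) q∣bp | inj₁ q∣b = contradiction 0<v λ ()
  notBothMultiples 0<v v<pq (divides (suc b) refl) q∣bp | inj₁ q∣b =
    <⇒≱ v<pq (subst (_≤ suc b * p) (*-comm q p) (*-monoˡ-≤ p (∣⇒≤ q∣b)))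

  S : ℕ → Bool
  S u = ⌊ p ∣? u ⌋

  annihilators-differ : ∀ {v u} → v ∈ zdVertices (p * q) → u ∈ zdVertices (p * q) →
                        p * q ∣ v * u → S u ≡ not (S v)
  annihilators-differ {v} {u} v∈V u∈V n∣vu with p ∣? u | p ∣? v
  ... | yes _   | no _    = refl
  ... | no _    | yes _   = refl
  ... | no p∤u  | no p∤v  = ⊥-elim ([ p∤v , p∤u ] (prime-divides-factor v u p-prime (m∣m*n q) n∣vu))
  ... | yes p∣u | yes p∣v =
    ⊥-elim ([ notBoth v∈V p∣v , notBoth u∈V p∣u ]
              (prime-divides-factor v u q-prime (n∣m*n p) n∣vu))
    where
    notBoth : ∀ {w} → w ∈ zdVertices (p * q) → p ∣ w → ¬ q ∣ w
    notBoth w∈V with 0<w , w<n ← vertex-range w∈V = notBothMultiples 0<w w<n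

  edgesCross : EdgesCross (ZDGraph (p * q)) S
  edgesCross {v} {u} v∈V u∈V vu =
    annihilators-differ v∈V u∈V (mulZero⇒∣ v u (∧-conicalˡ _ _ vu))

  -- An annihilator of v has the other colour, hence differs from v.
  noIsolatedVertex : NoIsolatedVertex (ZDGraph (p * q))
  noIsolatedVertex {v} v∈V with u , u∈V , n∣vu ← vertex-annihilator v∈V = u , u∈V , adjacent , u≢v
    where
    u≢v : u ≢ v
    u≢v u≡v = not-¬ (cong S u≡v) (annihilators-differ v∈V u∈V n∣vu)

    adjacent : adj (ZDGraph (p * q)) v u ≡ true
    adjacent = cong₂ _∧_ (∣⇒mulZero v u n∣vu)
                         (distinct⇒unequal (λ v≡u → u≢v (sym v≡u)))

mainTheorem2 : (p q : ℕ) → Prime p → Prime q → p ≢ q →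
    VeryCostEffectiveGraph (ZDGraph (p * q))
mainTheorem2 p q p-prime q-prime p≢q =
  bipartite⇒veryCostEffective (ZDGraph (p * q)) S edgesCross noIsolatedVertex
  where open DistinctPrimes p q p-prime q-prime p≢q
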